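{- Let $R$ be a complete discrete valuation ring with maximal ideal $\mathfrak{p}=pR$ and field of fractions $F$. Fix $n\ge1$, $\gamma=\begin{pmatrix}0&1\\ p^n&0\end{pmatrix}$, $\mathcal{O}=\operatorname{M}_2(R)\cap\gamma^{ -1}\operatorname{M}_2(R)\gamma=\begin{pmatrix}R&R\\ \mathfrak{p}^n&R\end{pmatrix}$. For each $s\in R/\mathfrak{p}$ choose $b_s\in R$ representing $s$ and set $\alpha_s=\begin{pmatrix}1&b_s\\0&p\end{pmatrix}$; let $S_1=\{\mathcal{O}\alpha_s : s\in R/\mathfrak{p}\}$ and $S_2=\{\mathcal{O}\gamma^{ -1}\alpha_s\gamma : s\in R/\mathfrak{p}\}$. Then for every $\omega\in\mathcal{O}^\times$, the permutation $\sigma_\omega\colon P\mapsto P\omega$ maps $S_1$ onto $S_1$ and $S_2$ onto $S_2$.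
   Context: The elements of $S_1$ and $S_2$ are principal left ideals of $\mathcal{O}$ of reduced norm $\mathfrak{p}$ (reduced norm $=\det$). -}

module Defs where

open import Level using (Level; _⊔_; suc)
open import Algebra.Bundles using (CommutativeRing)
open import Data.Nat using (ℕ; zero) renaming (suc to sucℕ)
open import Data.Product using (Σ; _×_; _,_; ∃)
open import Data.Sum using (_⊎_)
open import Relation.Nullary using (¬_)
open import Relation.Binary.PropositionalEquality using (_≡_)

record M2 {c} (A : Set c) : Set c where
  constructor mat
  field
    e11 e12 e21 e22 : A
open M2 public

module _ {c ℓ : Level} (R : CommutativeRing c ℓ) where
  open CommutativeRing R

  Divides : Carrier → Carrier → Set (c ⊔ ℓ)
  Divides x y = Σ Carrier λ z → y ≈ x * z

  IsUnit : Carrier → Set (c ⊔ ℓ)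
  IsUnit u = Σ Carrier λ v → u * v ≈ 1#

  pow : Carrier → ℕ → Carrier
  pow x zero = 1#
  pow x (sucℕ k) = x * pow x k

  -- R is a complete discrete valuation ring with uniformizer p (maximal ideal pR):
  -- an integral domain, p nonzero non-unit, every nonzero element is a unit times a
  -- power of p, and R is complete for the p-adic topology (every p-adically Cauchy
  -- sequence, in the form a(m+1) ≡ a(m) mod p^m, has a limit).
  record IsCompleteDVR (p : Carrier) : Set (c ⊔ ℓ) where
    field
      nontrivial  : ¬ (1# ≈ 0#)
      noZeroDiv   : ∀ x y → x * y ≈ 0# → x ≈ 0# ⊎ y ≈ 0#
      p≉0         : ¬ (p ≈ 0#)
      p-nonunit   : ¬ IsUnit p
      uniformizer : ∀ x → ¬ (x ≈ 0#) → Σ Carrier λ u → Σ ℕ λ k → IsUnit u × x ≈ u * pow p k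
      complete    : (a : ℕ → Carrier) →
                    (∀ m → Divides (pow p m) (a (sucℕ m) - a m)) →
                    Σ Carrier λ L → ∀ m → Divides (pow p m) (L - a m)

  -- b : I → R is a choice of one representative b_s for each residue class s ∈ R/pR
  -- (the index type I plays the role of R/p).
  IsResidueSystem : (p : Carrier) {i : Level} {I : Set i} → (I → Carrier) → Set (c ⊔ ℓ ⊔ i)
  IsResidueSystem p {I = I} b =
    (∀ r → Σ I λ s → Divides p (r - b s)) ×
    (∀ s t → Divides p (b s - b t) → s ≡ t)

  _≈M_ : M2 Carrier → M2 Carrier → Set ℓ
  x ≈M y = (e11 x ≈ e11 y) × (e12 x ≈ e12 y) × (e21 x ≈ e21 y) × (e22 x ≈ e22 y)

  _*M_ : M2 Carrier → M2 Carrier → M2 Carrier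
  x *M y = mat (e11 x * e11 y + e12 x * e21 y) (e11 x * e12 y + e12 x * e22 y)
               (e21 x * e11 y + e22 x * e21 y) (e21 x * e12 y + e22 x * e22 y)

  idM : M2 Carrier
  idM = mat 1# 0# 0# 1#

  gammaM : Carrier → ℕ → M2 Carrier
  gammaM p n = mat 0# 1# (pow p n) 0#

  alphaM : Carrier → Carrier → M2 Carrier
  alphaM p bs = mat 1# bs 0# p

  InO : Carrier → ℕ → M2 Carrier → Set (c ⊔ ℓ)
  InO p n x = Divides (pow p n) (e21 x)

  IsUnitO : Carrier → ℕ → M2 Carrier → Set (c ⊔ ℓ)
  IsUnitO p n ω = InO p n ω × Σ (M2 Carrier) λ ω' → InO p n ω' × (ω *M ω') ≈M idM × (ω' *M ω) ≈M idM

  MSet : Set (suc (c ⊔ ℓ))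
  MSet = M2 Carrier → Set (c ⊔ ℓ)

  _≐_ : MSet → MSet → Set (c ⊔ ℓ)
  P ≐ Q = ∀ x → (P x → Q x) × (Q x → P x)

  LeftIdeal : Carrier → ℕ → M2 Carrier → MSet
  LeftIdeal p n β x = Σ (M2 Carrier) λ o → InO p n o × x ≈M (o *M β)

  RightMul : MSet → M2 Carrier → MSet
  RightMul P ω x = Σ (M2 Carrier) λ y → P y × x ≈M (y *M ω)

  S1 : Carrier → ℕ → {i : Level} {I : Set i} → (I → Carrier) → MSet → Set (c ⊔ ℓ ⊔ i)
  S1 p n {I = I} b P = Σ I λ s → P ≐ LeftIdeal p n (alphaM p (b s))

  -- S₂ = { 𝒪 γ⁻¹ α_s γ : s ∈ R/p }.  Since R is a domain and γ is invertible over F,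
  -- γ⁻¹ α_s γ is the unique matrix β with γ β = α_s γ; it lies in M2(R).
  S2 : Carrier → ℕ → {i : Level} {I : Set i} → (I → Carrier) → MSet → Set (c ⊔ ℓ ⊔ i)
  S2 p n {I = I} b P = Σ I λ s → Σ (M2 Carrier) λ β →
    ((gammaM p n *M β) ≈M (alphaM p (b s) *M gammaM p n)) × (P ≐ LeftIdeal p n β)

  MapsOnto : {k : Level} → (MSet → Set k) → M2 Carrier → Set (suc (c ⊔ ℓ) ⊔ k)
  MapsOnto S ω =
    (∀ P → S P → S (RightMul P ω)) ×
    (∀ Q → S Q → Σ MSet λ P → S P × (RightMul P ω ≐ Q))

module Submission where

-- The whole argument is an abstract criterion for a family of principal
-- left ideals 𝒪β_s (s ∈ I) to be permuted by 𝒪^×: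
--   (factor)    for every unit ω and every s there are t and ω' ∈ 𝒪 with β_s ω = ω' β_t,
--               so that 𝒪β_s ω = 𝒪ω'β_t ⊆ 𝒪β_t;
--   (separate)  β_s ∈ 𝒪β_t forces s = t.
-- Applying (factor) to ω and then to ω⁻¹ and using (separate) shows 𝒪β_s ω = 𝒪β_t.
--
-- For αₛ and βₛ = [[p,0],[bₛpⁿ,1]]
-- the factorisation needs only that the diagonal entries of a unit of 𝒪 are units
-- modulo p (this is where n ≥ 1 is used) and the choice of t as the residue class of
-- a⁻¹(B + bₛd), resp. d⁻¹(bₛa + c/pⁿ), for ω = [[a,B],[c,d]].

open import Defs
open import Level using (Level; _⊔_)
open import Algebra.Bundles using (CommutativeRing)
open import Data.Nat using (ℕ; zero; _≤_; z≤n; s≤s) renaming (suc to sucℕ)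
open import Data.Product using (_×_; Σ; _,_; proj₁; proj₂)
open import Data.Sum using (_⊎_; inj₁; inj₂)
open import Relation.Binary.Bundles using (Setoid)
open import Data.Empty using (⊥-elim)
open import Relation.Nullary using (¬_)
open import Relation.Binary.PropositionalEquality as P using (_≡_)

-- Congruence modulo an element m of a commutative ring, in the negation-free form
-- x + m u = y + m v, so that its compatibility laws are semiring identities.
module Congruence {c ℓ} (R : CommutativeRing c ℓ) (m : CommutativeRing.Carrier R) where
  open CommutativeRing R
  open import Algebra.Solver.Ring.NaturalCoefficients.Default commutativeSemiring
  open import Algebra.Properties.Ring ring using (-‿distribʳ-*; //-rightDividesˡ; //-rightDividesʳ)
  open import Relation.Binary.Reasoning.Setoid setoid

  infix 4 _≡ₘ_
  _≡ₘ_ : Carrier → Carrier → Set (c ⊔ ℓ)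
  x ≡ₘ y = Σ Carrier λ u → Σ Carrier λ v → x + m * u ≈ y + m * v

  ≡ₘ-refl : ∀ {x} → x ≡ₘ x
  ≡ₘ-refl = 0# , 0# , refl

  ≡ₘ-sym : ∀ {x y} → x ≡ₘ y → y ≡ₘ x
  ≡ₘ-sym (u , v , e) = v , u , sym e

  ≡ₘ-trans : ∀ {x y z} → x ≡ₘ y → y ≡ₘ z → x ≡ₘ z
  ≡ₘ-trans {x} {y} {z} (u , v , e) (u' , v' , e') = u + u' , v' + v , (begin
    x + m * (u + u')       ≈⟨ solve 4 (λ x m u u' → x :+ m :* (u :+ u') := (x :+ m :* u) :+ m :* u') refl x m u u' ⟩
    (x + m * u) + m * u'   ≈⟨ +-cong e refl ⟩
    (y + m * v) + m * u'   ≈⟨ solve 4 (λ y m v u' → (y :+ m :* v) :+ m :* u' := (y :+ m :* u') :+ m :* v) refl y m v u' ⟩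
    (y + m * u') + m * v   ≈⟨ +-cong e' refl ⟩
    (z + m * v') + m * v   ≈⟨ solve 4 (λ z m v' v → (z :+ m :* v') :+ m :* v := z :+ m :* (v' :+ v)) refl z m v' v ⟩
    z + m * (v' + v)       ∎)

  ≡ₘ-setoid : Setoid c (c ⊔ ℓ)
  ≡ₘ-setoid = record
    { Carrier = Carrier
    ; _≈_ = _≡ₘ_
    ; isEquivalence = record { refl = ≡ₘ-refl ; sym = ≡ₘ-sym ; trans = ≡ₘ-trans }
    }

  ≈⇒≡ₘ : ∀ {x y} → x ≈ y → x ≡ₘ y
  ≈⇒≡ₘ e = 0# , 0# , +-cong e refl

  +-≡ₘ : ∀ {x y x' y'} → x ≡ₘ y → x' ≡ₘ y' → x + x' ≡ₘ y + y'
  +-≡ₘ {x} {y} {x'} {y'} (u , v , e) (u' , v' , e') = u + u' , v + v' , (begin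
    (x + x') + m * (u + u')     ≈⟨ solve 5 (λ x x' m u u' → (x :+ x') :+ m :* (u :+ u') := (x :+ m :* u) :+ (x' :+ m :* u')) refl x x' m u u' ⟩
    (x + m * u) + (x' + m * u') ≈⟨ +-cong e e' ⟩
    (y + m * v) + (y' + m * v') ≈⟨ solve 5 (λ y y' m v v' → (y :+ m :* v) :+ (y' :+ m :* v') := (y :+ y') :+ m :* (v :+ v')) refl y y' m v v' ⟩
    (y + y') + m * (v + v')     ∎)

  *-≡ₘ : ∀ {x y x' y'} → x ≡ₘ y → x' ≡ₘ y' → x * x' ≡ₘ y * y'
  *-≡ₘ {x} {y} {x'} {y'} (u , v , e) (u' , v' , e') = u * x' + u' * y , v' * y + v * x' , (begin
    x * x' + m * (u * x' + u' * y)   ≈⟨ solve 6 (λ x x' y m u u' → x :* x' :+ m :* (u :* x' :+ u' :* y) := (x :+ m :* u) :* x' :+ m :* (u' :* y)) refl x x' y m u u' ⟩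
    (x + m * u) * x' + m * (u' * y)  ≈⟨ +-cong (*-cong e refl) refl ⟩
    (y + m * v) * x' + m * (u' * y)  ≈⟨ solve 5 (λ x' y m v u' → (y :+ m :* v) :* x' :+ m :* (u' :* y) := y :* (x' :+ m :* u') :+ m :* (v :* x')) refl x' y m v u' ⟩
    y * (x' + m * u') + m * (v * x') ≈⟨ +-cong (*-cong refl e') refl ⟩
    y * (y' + m * v') + m * (v * x') ≈⟨ solve 6 (λ x' y y' m v v' → y :* (y' :+ m :* v') :+ m :* (v :* x') := y :* y' :+ m :* (v' :* y :+ v :* x')) refl x' y y' m v v' ⟩
    y * y' + m * (v' * y + v * x')   ∎)

  multiple≡ₘ0 : ∀ {x z} → x ≈ m * z → x ≡ₘ 0#
  multiple≡ₘ0 {x} {z} e = 0# , z , (begin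
    x + m * 0#  ≈⟨ solve 2 (λ x m → x :+ m :* con 0 := x) refl x m ⟩
    x           ≈⟨ e ⟩
    m * z       ≈⟨ sym (+-identityˡ _) ⟩
    0# + m * z  ∎)

  divides⇒≡ₘ : ∀ {x y} → Divides R m (x - y) → x ≡ₘ y
  divides⇒≡ₘ {x} {y} (z , e) = 0# , z , (begin
    x + m * 0#  ≈⟨ solve 2 (λ x m → x :+ m :* con 0 := x) refl x m ⟩
    x           ≈⟨ //-rightDividesˡ y x ⟨
    (x - y) + y ≈⟨ +-cong e refl ⟩
    m * z + y   ≈⟨ +-comm _ _ ⟩
    y + m * z   ∎)

  ≡ₘ⇒offset : ∀ {x y} → x ≡ₘ y → Σ Carrier λ k → x ≈ y + m * k
  ≡ₘ⇒offset {x} {y} (u , v , e) = v + - u , (begin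
    x                           ≈⟨ //-rightDividesʳ (m * u) x ⟨
    (x + m * u) - m * u         ≈⟨ +-cong e (-‿distribʳ-* m u) ⟩
    (y + m * v) + m * - u       ≈⟨ solve 4 (λ y m v w → (y :+ m :* v) :+ m :* w := y :+ m :* (v :+ w)) refl y m v (- u) ⟩
    y + m * (v + - u)           ∎)

  ≡ₘ⇒divides : ∀ {x y} → x ≡ₘ y → Divides R m (x - y)
  ≡ₘ⇒divides {x} {y} h = let (k , e) = ≡ₘ⇒offset h in k , (begin
    x - y            ≈⟨ +-cong e refl ⟩
    (y + m * k) - y  ≈⟨ +-cong (+-comm y _) refl ⟩
    (m * k + y) - y  ≈⟨ //-rightDividesʳ y (m * k) ⟩
    m * k            ∎)

module Domain {c ℓ} (R : CommutativeRing c ℓ) where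
  open CommutativeRing R
  open import Algebra.Properties.Ring ring using (-‿distribʳ-*; //-rightDividesˡ)
  open import Relation.Binary.Reasoning.Setoid setoid

  module _ (1≉0 : ¬ (1# ≈ 0#)) (noZeroDiv : ∀ x y → x * y ≈ 0# → x ≈ 0# ⊎ y ≈ 0#) where

    pow-nonzero : ∀ {x} → ¬ (x ≈ 0#) → ∀ k → ¬ (pow R x k ≈ 0#)
    pow-nonzero x≉0 zero e = 1≉0 e
    pow-nonzero x≉0 (sucℕ k) e with noZeroDiv _ _ e
    ... | inj₁ x≈0 = x≉0 x≈0
    ... | inj₂ xᵏ≈0 = pow-nonzero x≉0 k xᵏ≈0

    cancelˡ : ∀ {z x y} → ¬ (z ≈ 0#) → z * x ≈ z * y → x ≈ y
    cancelˡ {z} {x} {y} z≉0 e with noZeroDiv z (x - y) (begin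
        z * (x - y)           ≈⟨ distribˡ z x (- y) ⟩
        z * x + z * - y       ≈⟨ +-cong e (sym (-‿distribʳ-* z y)) ⟩
        z * y - z * y         ≈⟨ -‿inverseʳ _ ⟩
        0#                    ∎)
    ... | inj₁ z≈0 = ⊥-elim (z≉0 z≈0)
    ... | inj₂ x-y≈0 = begin
        x            ≈⟨ //-rightDividesˡ y x ⟨
        (x - y) + y  ≈⟨ +-cong x-y≈0 refl ⟩
        0# + y       ≈⟨ +-identityˡ y ⟩
        y            ∎

module Matrix {c ℓ} (R : CommutativeRing c ℓ) where
  open CommutativeRing R
  open import Algebra.Solver.Ring.NaturalCoefficients.Default commutativeSemiring

  infixl 7 _·_
  _·_ : M2 Carrier → M2 Carrier → M2 Carrier
  _·_ = _*M_ R

  infix 4 _≋_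
  _≋_ : M2 Carrier → M2 Carrier → Set ℓ
  _≋_ = _≈M_ R

  ≋-refl : ∀ {x} → x ≋ x
  ≋-refl = refl , refl , refl , refl

  ≋-sym : ∀ {x y} → x ≋ y → y ≋ x
  ≋-sym (e₁ , e₂ , e₃ , e₄) = sym e₁ , sym e₂ , sym e₃ , sym e₄

  ≋-trans : ∀ {x y z} → x ≋ y → y ≋ z → x ≋ z
  ≋-trans (e₁ , e₂ , e₃ , e₄) (f₁ , f₂ , f₃ , f₄) = trans e₁ f₁ , trans e₂ f₂ , trans e₃ f₃ , trans e₄ f₄

  ·-cong : ∀ {x x' y y'} → x ≋ x' → y ≋ y' → x · y ≋ x' · y'
  ·-cong (e₁ , e₂ , e₃ , e₄) (f₁ , f₂ , f₃ , f₄) =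
    +-cong (*-cong e₁ f₁) (*-cong e₂ f₃) , +-cong (*-cong e₁ f₂) (*-cong e₂ f₄) ,
    +-cong (*-cong e₃ f₁) (*-cong e₄ f₃) , +-cong (*-cong e₃ f₂) (*-cong e₄ f₄)

  ·-assoc : ∀ x y z → (x · y) · z ≋ x · (y · z)
  ·-assoc (mat x₁ x₂ x₃ x₄) (mat y₁ y₂ y₃ y₄) (mat z₁ z₂ z₃ z₄) =
    entry x₁ x₂ z₁ z₃ , entry x₁ x₂ z₂ z₄ , entry x₃ x₄ z₁ z₃ , entry x₃ x₄ z₂ z₄
    where
    entry : ∀ a b i k → (a * y₁ + b * y₃) * i + (a * y₂ + b * y₄) * k ≈ a * (y₁ * i + y₂ * k) + b * (y₃ * i + y₄ * k)
    entry a b i k = solve 8 (λ a b y₁ y₂ y₃ y₄ i k → (a :* y₁ :+ b :* y₃) :* i :+ (a :* y₂ :+ b :* y₄) :* k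
                                           := a :* (y₁ :* i :+ y₂ :* k) :+ b :* (y₃ :* i :+ y₄ :* k)) refl a b y₁ y₂ y₃ y₄ i k

  ·-identityˡ : ∀ x → idM R · x ≋ x
  ·-identityˡ (mat x₁ x₂ x₃ x₄) = left x₁ x₃ , left x₂ x₄ , right x₁ x₃ , right x₂ x₄
    where
    left : ∀ a b → 1# * a + 0# * b ≈ a
    left = solve 2 (λ a b → con 1 :* a :+ con 0 :* b := a) refl
    right : ∀ a b → 0# * a + 1# * b ≈ b
    right = solve 2 (λ a b → con 0 :* a :+ con 1 :* b := b) refl

  ·-identityʳ : ∀ x → x · idM R ≋ x
  ·-identityʳ (mat x₁ x₂ x₃ x₄) = left x₁ x₂ , right x₁ x₂ , left x₃ x₄ , right x₃ x₄
    where
    left : ∀ a b → a * 1# + b * 0# ≈ a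
    left = solve 2 (λ a b → a :* con 1 :+ b :* con 0 := a) refl
    right : ∀ a b → a * 0# + b * 1# ≈ b
    right = solve 2 (λ a b → a :* con 0 :+ b :* con 1 := b) refl

module Order {c ℓ} (R : CommutativeRing c ℓ) (p : CommutativeRing.Carrier R) (n : ℕ) where
  open CommutativeRing R
  open Matrix R
  open import Algebra.Solver.Ring.NaturalCoefficients.Default commutativeSemiring

  q : Carrier
  q = pow R p n

  𝒪 : M2 Carrier → Set (c ⊔ ℓ)
  𝒪 = InO R p n

  𝒪-identity : 𝒪 (idM R)
  𝒪-identity = 0# , sym (zeroʳ q)

  𝒪-· : ∀ {x y} → 𝒪 x → 𝒪 y → 𝒪 (x · y)
  𝒪-· {mat _ _ x₃ x₄} {mat y₁ _ y₃ _} (u , x₃≈qu) (v , y₃≈qv) = u * y₁ + x₄ * v , (begin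
    x₃ * y₁ + x₄ * y₃             ≈⟨ +-cong (*-cong x₃≈qu refl) (*-cong refl y₃≈qv) ⟩
    (q * u) * y₁ + x₄ * (q * v)   ≈⟨ solve 5 (λ q u y₁ x₄ v → (q :* u) :* y₁ :+ x₄ :* (q :* v) := q :* (u :* y₁ :+ x₄ :* v)) refl q u y₁ x₄ v ⟩
    q * (u * y₁ + x₄ * v)         ∎)
    where open import Relation.Binary.Reasoning.Setoid setoid

  Unit : M2 Carrier → Set (c ⊔ ℓ)
  Unit = IsUnitO R p n

  inverse : ∀ {ω} → Unit ω → M2 Carrier
  inverse (_ , ω⁻¹ , _) = ω⁻¹

  inverse-unit : ∀ {ω} (U : Unit ω) → Unit (inverse U)
  inverse-unit {ω} (ω∈𝒪 , ω⁻¹ , ω⁻¹∈𝒪 , right , left) = ω⁻¹∈𝒪 , ω , ω∈𝒪 , left , right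

  ·-cancelʳ : ∀ {ω} (U : Unit ω) x → (x · ω) · inverse U ≋ x
  ·-cancelʳ {ω} (_ , ω⁻¹ , _ , ωω⁻¹≋1 , _) x =
    ≋-trans (·-assoc x ω ω⁻¹) (≋-trans (·-cong (≋-refl {x}) ωω⁻¹≋1) (·-identityʳ x))

  infix 4 _⊆_
  _⊆_ : MSet R → MSet R → Set (c ⊔ ℓ)
  P ⊆ Q = ∀ x → P x → Q x

  ⊆-antisym : ∀ {P Q} → P ⊆ Q → Q ⊆ P → _≐_ R P Q
  ⊆-antisym P⊆Q Q⊆P x = P⊆Q x , Q⊆P x

  ≐-sym : ∀ {P Q} → _≐_ R P Q → _≐_ R Q P
  ≐-sym P≐Q x = proj₂ (P≐Q x) , proj₁ (P≐Q x)

  ≐-trans : ∀ {P Q T} → _≐_ R P Q → _≐_ R Q T → _≐_ R P T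
  ≐-trans P≐Q Q≐T x = (λ Px → proj₁ (Q≐T x) (proj₁ (P≐Q x) Px)) , (λ Tx → proj₂ (P≐Q x) (proj₂ (Q≐T x) Tx))

  Closed : MSet R → Set (c ⊔ ℓ)
  Closed P = ∀ {x y} → P x → x ≋ y → P y

  Closed-≐ : ∀ {P Q} → _≐_ R P Q → Closed P → Closed Q
  Closed-≐ P≐Q closed {x} {y} Qx x≋y = proj₁ (P≐Q y) (closed (proj₂ (P≐Q x) Qx) x≋y)

  _·ω_ : MSet R → M2 Carrier → MSet R
  _·ω_ = RightMul R

  ·ω-cong : ∀ {P Q} ω → _≐_ R P Q → _≐_ R (P ·ω ω) (Q ·ω ω)
  ·ω-cong ω P≐Q x = (λ (y , Py , e) → y , proj₁ (P≐Q y) Py , e) , (λ (y , Qy , e) → y , proj₂ (P≐Q y) Qy , e)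

  ·ω-inverse : ∀ {ω P} (U : Unit ω) → Closed P → _≐_ R ((P ·ω inverse U) ·ω ω) P
  ·ω-inverse {ω} {P} U closed = ⊆-antisym back forth
    where
    U⁻¹ : Unit (inverse U)
    U⁻¹ = inverse-unit U
    back : (P ·ω inverse U) ·ω ω ⊆ P
    back x (y , (z , Pz , y≋zω⁻¹) , x≋yω) =
      closed Pz (≋-sym (≋-trans x≋yω (≋-trans (·-cong y≋zω⁻¹ ≋-refl) (·-cancelʳ U⁻¹ z))))
    forth : P ⊆ (P ·ω inverse U) ·ω ω
    forth x Px = x · inverse U , (x , Px , ≋-refl) , ≋-sym (·-cancelʳ U⁻¹ x)

  L : M2 Carrier → MSet R
  L = LeftIdeal R p n

  L-closed : ∀ β → Closed (L β)
  L-closed β (o , o∈𝒪 , x≋oβ) x≋y = o , o∈𝒪 , ≋-trans (≋-sym x≋y) x≋oβ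

  generator∈L : ∀ β → L β β
  generator∈L β = idM R , 𝒪-identity , ≋-sym (·-identityˡ β)

  L-cong : ∀ {β β'} → β ≋ β' → _≐_ R (L β) (L β')
  L-cong {β} {β'} β≋β' =
    ⊆-antisym (λ x (o , o∈𝒪 , x≋oβ) → o , o∈𝒪 , ≋-trans x≋oβ (·-cong ≋-refl β≋β'))
              (λ x (o , o∈𝒪 , x≋oβ') → o , o∈𝒪 , ≋-trans x≋oβ' (·-cong ≋-refl (≋-sym β≋β')))

  L·ω-⊆ : ∀ {β ω ω' β'} → 𝒪 ω' → β · ω ≋ ω' · β' → L β ·ω ω ⊆ L β'
  L·ω-⊆ {β} {ω} {ω'} {β'} ω'∈𝒪 βω≋ω'β' x (y , (o , o∈𝒪 , y≋oβ) , x≋yω) =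
    o · ω' , 𝒪-· {o} {ω'} o∈𝒪 ω'∈𝒪 ,
    ≋-trans x≋yω (≋-trans (·-cong y≋oβ (≋-refl {ω})) (≋-trans (·-assoc o β ω)
      (≋-trans (·-cong (≋-refl {o}) βω≋ω'β') (≋-sym (·-assoc o ω' β')))))

  module Permutation {i} {I : Set i} (β : I → M2 Carrier)
    (factor : ∀ {ω} → Unit ω → ∀ s → Σ I λ t → Σ (M2 Carrier) λ ω' → 𝒪 ω' × β s · ω ≋ ω' · β t)
    (separate : ∀ {s t} → L (β t) (β s) → s ≡ t) where

    target : ∀ {ω} → Unit ω → I → I
    target U s = proj₁ (factor U s)

    image-⊆ : ∀ {ω} (U : Unit ω) s → L (β s) ·ω ω ⊆ L (β (target U s))
    image-⊆ U s = let (_ , _ , ω'∈𝒪 , βω≋ω'β) = factor U s in L·ω-⊆ ω'∈𝒪 βω≋ω'β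

    -- β_s = (β_s ω) ω⁻¹ lies in (𝒪β_t) ω⁻¹ ⊆ 𝒪β_{t'} for the target t' of t under ω⁻¹,
    -- so t' = s by (separate)
    target-inverse : ∀ {ω} (U : Unit ω) s → target (inverse-unit U) (target U s) ≡ s
    target-inverse {ω} U s = P.sym (separate (L-closed (β _)
      (image-⊆ (inverse-unit U) (target U s) (β s · ω · inverse U)
        (β s · ω , image-⊆ U s (β s · ω) (β s , generator∈L (β s) , ≋-refl {β s · ω}) , ≋-refl {β s · ω · inverse U}))
      (·-cancelʳ U (β s))))

    -- (𝒪β_s) ω = 𝒪β_t: the reverse inclusion is the forward one for ω⁻¹
    image : ∀ {ω} (U : Unit ω) s → _≐_ R (L (β s) ·ω ω) (L (β (target U s)))
    image {ω} U s = ⊆-antisym (image-⊆ U s) λ x x∈L →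
      x · inverse U ,
      P.subst (λ r → L (β r) (x · inverse U)) (target-inverse U s)
        (image-⊆ (inverse-unit U) (target U s) (x · inverse U) (x , x∈L , ≋-refl {x · inverse U})) ,
      ≋-sym (·-cancelʳ (inverse-unit U) x)

    mapsOnto : ∀ {k} (S : MSet R → Set k) →
               (∀ P → S P → Σ I λ s → _≐_ R P (L (β s))) →
               (∀ P s → _≐_ R P (L (β s)) → S P) →
               ∀ {ω} → Unit ω → MapsOnto R S ω
    mapsOnto S toFamily fromFamily {ω} U = forward U , onto
      where
      forward : ∀ {ω} → Unit ω → ∀ P → S P → S (P ·ω ω)
      forward {ω} U P SP =
        let (s , P≐L) = toFamily P SP
        in fromFamily (P ·ω ω) (target U s) (≐-trans (·ω-cong ω P≐L) (image U s))
      onto : ∀ Q → S Q → Σ (MSet R) λ P → S P × _≐_ R (P ·ω ω) Q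
      onto Q SQ =
        let (s , Q≐L) = toFamily Q SQ
        in Q ·ω inverse U , forward (inverse-unit U) Q SQ ,
           ·ω-inverse U (Closed-≐ (≐-sym Q≐L) (L-closed (β s)))

module Eichler {c ℓ} (R : CommutativeRing c ℓ) (p : CommutativeRing.Carrier R)
               (D : IsCompleteDVR R p) (m : ℕ)
               {i} (I : Set i) (b : I → CommutativeRing.Carrier R) (residues : IsResidueSystem R p b) where
  open CommutativeRing R
  open IsCompleteDVR D using (nontrivial; noZeroDiv; p≉0)
  open Congruence R p
  open Domain R using (pow-nonzero; cancelˡ)
  open Matrix R
  open Order R p (sucℕ m)
  open import Algebra.Properties.Ring ring using (//-rightDividesˡ)
  open import Algebra.Solver.Ring.NaturalCoefficients.Default commutativeSemiring
  import Relation.Binary.Reasoning.Setoid as Reasoning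

  module ≈-Reasoning = Reasoning setoid
  module ≡ₘ-Reasoning = Reasoning ≡ₘ-setoid

  p≡ₘ0 : p ≡ₘ 0#
  p≡ₘ0 = multiple≡ₘ0 (sym (*-identityʳ p))

  -- since n ≥ 1, pⁿ and hence the lower-left entry of any element of 𝒪 vanish mod p
  q≡ₘ0 : q ≡ₘ 0#
  q≡ₘ0 = multiple≡ₘ0 refl

  lowerLeft≡ₘ0 : ∀ {x} → 𝒪 x → e21 x ≡ₘ 0#
  lowerLeft≡ₘ0 (u , e) = multiple≡ₘ0 (trans e (*-assoc p (pow R p m) u))

  cancel-q : ∀ {x y} → q * x ≈ q * y → x ≈ y
  cancel-q = cancelˡ nontrivial noZeroDiv (pow-nonzero nontrivial noZeroDiv p≉0 (sucℕ m))

  residue : ∀ r → Σ I λ t → b t ≡ₘ r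
  residue r = let (t , p∣r-bt) = proj₁ residues r in t , ≡ₘ-sym (divides⇒≡ₘ p∣r-bt)

  residue-unique : ∀ {s t} → b s ≡ₘ b t → s ≡ t
  residue-unique bs≡bt = proj₂ residues _ _ (≡ₘ⇒divides bs≡bt)

  sub-add-scaled : ∀ x u w → (w - u) * x + x * u ≈ x * w
  sub-add-scaled x u w = begin
    (w - u) * x + x * u   ≈⟨ solve 4 (λ x u w v → (w :+ v) :* x :+ x :* u := x :* ((w :+ v) :+ u)) refl x u w (- u) ⟩
    x * ((w - u) + u)     ≈⟨ *-cong refl (//-rightDividesˡ u w) ⟩
    x * w                 ∎
    where open ≈-Reasoning

  -- The diagonal entries of a unit ω = [[a,_],[c,d]] of 𝒪 are invertible modulo p,
  -- with inverses the diagonal entries of ω⁻¹ (read off from ω⁻¹ω = 1, as c ≡ 0).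
  diagonal-units : ∀ {ω} (U : Unit ω) → (e11 (inverse U) * e11 ω ≡ₘ 1#) × (e22 (inverse U) * e22 ω ≡ₘ 1#)
  diagonal-units {mat a B c d} (c∈𝒪 , mat a' b' c' d' , c'∈𝒪 , _ , (E₁ , _ , _ , E₄)) = a'a≡1 , d'd≡1
    where
    open ≡ₘ-Reasoning
    a'a≡1 : a' * a ≡ₘ 1#
    a'a≡1 = begin
      a' * a             ≈⟨ ≈⇒≡ₘ (solve 3 (λ a' a b' → a' :* a := a' :* a :+ b' :* con 0) refl a' a b') ⟩
      a' * a + b' * 0#   ≈⟨ +-≡ₘ ≡ₘ-refl (*-≡ₘ ≡ₘ-refl (≡ₘ-sym (lowerLeft≡ₘ0 {mat a B c d} c∈𝒪))) ⟩
      a' * a + b' * c    ≈⟨ ≈⇒≡ₘ E₁ ⟩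
      1#                 ∎
    d'd≡1 : d' * d ≡ₘ 1#
    d'd≡1 = begin
      d' * d             ≈⟨ ≈⇒≡ₘ (solve 3 (λ d' d B → d' :* d := con 0 :* B :+ d' :* d) refl d' d B) ⟩
      0# * B + d' * d    ≈⟨ +-≡ₘ (*-≡ₘ (≡ₘ-sym (lowerLeft≡ₘ0 {mat a' b' c' d'} c'∈𝒪)) ≡ₘ-refl) ≡ₘ-refl ⟩
      c' * B + d' * d    ≈⟨ ≈⇒≡ₘ E₄ ⟩
      1#                 ∎

  α : I → M2 Carrier
  α s = alphaM R p (b s)

  -- For ω = [[a,B],[c,d]] ∈ 𝒪^× let b_t ≡ a⁻¹(B + bₛd).  Then
  -- αₛ ω = [[a + bₛc, k],[pc, d - c b_t]] α_t  where  B + bₛd = (a + bₛc) b_t + p k.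
  α-factor : ∀ {ω} → Unit ω → ∀ s → Σ I λ t → Σ (M2 Carrier) λ ω' → 𝒪 ω' × α s · ω ≋ ω' · α t
  α-factor {mat a B c d} U s = t , mat (a + bₛ * c) k (p * c) (d - c * b t) , ω'∈𝒪 , (e₁ , e₂ , e₃ , e₄)
    where
    bₛ a' r : Carrier
    bₛ = b s
    a' = e11 (inverse U)
    r = a' * (B + bₛ * d)
    t : I
    t = proj₁ (residue r)
    c∈𝒪 : 𝒪 (mat a B c d)
    c∈𝒪 = proj₁ U
    bt≡ : (a + bₛ * c) * b t ≡ₘ B + bₛ * d
    bt≡ = begin
      (a + bₛ * c) * b t              ≈⟨ *-≡ₘ (+-≡ₘ ≡ₘ-refl (*-≡ₘ ≡ₘ-refl (lowerLeft≡ₘ0 {mat a B c d} c∈𝒪))) (proj₂ (residue r)) ⟩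
      (a + bₛ * 0#) * (a' * (B + bₛ * d))
                                      ≈⟨ ≈⇒≡ₘ (solve 5 (λ a bₛ a' B d → (a :+ bₛ :* con 0) :* (a' :* (B :+ bₛ :* d)) := (a' :* a) :* (B :+ bₛ :* d)) refl a bₛ a' B d) ⟩
      (a' * a) * (B + bₛ * d)         ≈⟨ *-≡ₘ (proj₁ (diagonal-units U)) ≡ₘ-refl ⟩
      1# * (B + bₛ * d)               ≈⟨ ≈⇒≡ₘ (*-identityˡ _) ⟩
      B + bₛ * d                      ∎
      where open ≡ₘ-Reasoning
    k : Carrier
    k = proj₁ (≡ₘ⇒offset (≡ₘ-sym bt≡))
    offset : B + bₛ * d ≈ (a + bₛ * c) * b t + p * k
    offset = proj₂ (≡ₘ⇒offset (≡ₘ-sym bt≡))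
    ω'∈𝒪 : 𝒪 (mat (a + bₛ * c) k (p * c) (d - c * b t))
    ω'∈𝒪 = let (c₀ , c≈qc₀) = c∈𝒪 in p * c₀ , trans (*-cong refl c≈qc₀) (solve 3 (λ p q c₀ → p :* (q :* c₀) := q :* (p :* c₀)) refl p q c₀)
    e₁ : 1# * a + bₛ * c ≈ (a + bₛ * c) * 1# + k * 0#
    e₁ = solve 4 (λ a bₛ c k → con 1 :* a :+ bₛ :* c := (a :+ bₛ :* c) :* con 1 :+ k :* con 0) refl a bₛ c k
    e₂ : 1# * B + bₛ * d ≈ (a + bₛ * c) * b t + k * p
    e₂ = trans (+-cong (*-identityˡ B) refl) (trans offset (+-cong refl (*-comm p k)))
    e₃ : 0# * a + p * c ≈ (p * c) * 1# + (d - c * b t) * 0#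
    e₃ = solve 4 (λ a p c w → con 0 :* a :+ p :* c := (p :* c) :* con 1 :+ w :* con 0) refl a p c (d - c * b t)
    e₄ : 0# * B + p * d ≈ (p * c) * b t + (d - c * b t) * p
    e₄ = begin
      0# * B + p * d                      ≈⟨ trans (+-cong (zeroˡ B) refl) (+-identityˡ _) ⟩
      p * d                               ≈⟨ sub-add-scaled p (c * b t) d ⟨
      (d - c * b t) * p + p * (c * b t)   ≈⟨ trans (+-comm _ _) (+-cong (sym (*-assoc p c (b t))) refl) ⟩
      (p * c) * b t + (d - c * b t) * p   ∎
      where open ≈-Reasoning

  -- αₛ ∈ 𝒪α_t forces bₛ ≡ b_t (mod p), i.e. s = t.
  α-separate : ∀ {s t} → L (α t) (α s) → s ≡ t
  α-separate {s} {t} (mat o₁ o₂ _ _ , _ , (E₁ , E₂ , _ , _)) = residue-unique (begin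
    b s                       ≈⟨ ≈⇒≡ₘ E₂ ⟩
    o₁ * b t + o₂ * p         ≈⟨ +-≡ₘ ≡ₘ-refl (*-≡ₘ ≡ₘ-refl p≡ₘ0) ⟩
    o₁ * b t + o₂ * 0#        ≈⟨ ≈⇒≡ₘ (solve 3 (λ o₁ o₂ bt → o₁ :* bt :+ o₂ :* con 0 := (o₁ :* con 1 :+ o₂ :* con 0) :* bt) refl o₁ o₂ (b t)) ⟩
    (o₁ * 1# + o₂ * 0#) * b t ≈⟨ ≈⇒≡ₘ (*-cong (sym E₁) refl) ⟩
    1# * b t                  ≈⟨ ≈⇒≡ₘ (*-identityˡ (b t)) ⟩
    b t                       ∎)
    where open ≡ₘ-Reasoning

  S₁-permuted : ∀ {ω} → Unit ω → MapsOnto R (S1 R p (sucℕ m) b) ω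
  S₁-permuted = Permutation.mapsOnto α α-factor α-separate (S1 R p (sucℕ m) b) (λ _ S₁P → S₁P) (λ _ s P≐L → s , P≐L)

  -- The family S₂: βₛ = γ⁻¹αₛγ = [[p,0],[bₛpⁿ,1]].
  γ : M2 Carrier
  γ = gammaM R p (sucℕ m)

  β : I → M2 Carrier
  β s = mat p 0# (b s * q) 1#

  β-conjugate : ∀ s → γ · β s ≋ α s · γ
  β-conjugate s =
    solve 3 (λ p bₛ q → con 0 :* p :+ con 1 :* (bₛ :* q) := con 1 :* con 0 :+ bₛ :* q) refl p (b s) q ,
    solve 1 (λ bₛ → con 0 :* con 0 :+ con 1 :* con 1 := con 1 :* con 1 :+ bₛ :* con 0) refl (b s) ,
    solve 3 (λ p bₛ q → q :* p :+ con 0 :* (bₛ :* q) := con 0 :* con 0 :+ p :* q) refl p (b s) q ,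
    solve 2 (λ p q → q :* con 0 :+ con 0 :* con 1 := con 0 :* con 1 :+ p :* con 0) refl p q

  -- γ is cancellable (pⁿ ≠ 0 in the domain R), so βₛ is the only solution of γβ = αₛγ.
  β-unique : ∀ s {β'} → γ · β' ≋ α s · γ → β' ≋ β s
  β-unique s {mat y₁ y₂ y₃ y₄} (G₁ , G₂ , G₃ , G₄) =
    cancel-q (trans (sym (solve 3 (λ q y₁ y₃ → q :* y₁ :+ con 0 :* y₃ := q :* y₁) refl q y₁ y₃))
      (trans G₃ (solve 2 (λ p q → con 0 :* con 0 :+ p :* q := q :* p) refl p q))) ,
    cancel-q (trans (sym (solve 3 (λ q y₂ y₄ → q :* y₂ :+ con 0 :* y₄ := q :* y₂) refl q y₂ y₄))
      (trans G₄ (solve 2 (λ p q → con 0 :* con 1 :+ p :* con 0 := q :* con 0) refl p q))) ,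
    trans (sym (solve 2 (λ y₁ y₃ → con 0 :* y₁ :+ con 1 :* y₃ := y₃) refl y₁ y₃))
      (trans G₁ (solve 1 (λ y → con 1 :* con 0 :+ y := y) refl (b s * q))) ,
    trans (sym (solve 2 (λ y₂ y₄ → con 0 :* y₂ :+ con 1 :* y₄ := y₄) refl y₂ y₄))
      (trans G₂ (solve 1 (λ bₛ → con 1 :* con 1 :+ bₛ :* con 0 := con 1) refl (b s)))

  -- For ω = [[a,B],[c,d]] ∈ 𝒪^× with c = pⁿc₀ let b_t ≡ d⁻¹(bₛa + c₀).  Then
  -- βₛ ω = [[a - B b_t pⁿ, pB],[pⁿk, bₛpⁿB + d]] β_t  where  bₛa + c₀ = b_t(bₛpⁿB + d) + p k.
  β-factor : ∀ {ω} → Unit ω → ∀ s → Σ I λ t → Σ (M2 Carrier) λ ω' → 𝒪 ω' × β s · ω ≋ ω' · β t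
  β-factor {mat a B c d} U s = t , mat (a - B * (b t * q)) (p * B) (q * k) (bₛ * q * B + d) , (k , refl) , (e₁ , e₂ , e₃ , e₄)
    where
    bₛ c₀ d' r : Carrier
    bₛ = b s
    c₀ = proj₁ (proj₁ U)
    d' = e22 (inverse U)
    r = d' * (bₛ * a + c₀)
    c≈qc₀ : c ≈ q * c₀
    c≈qc₀ = proj₂ (proj₁ U)
    t : I
    t = proj₁ (residue r)
    bt≡ : b t * (bₛ * q * B + d) ≡ₘ bₛ * a + c₀
    bt≡ = begin
      b t * (bₛ * q * B + d)                ≈⟨ *-≡ₘ (proj₂ (residue r)) (+-≡ₘ (*-≡ₘ (*-≡ₘ ≡ₘ-refl q≡ₘ0) ≡ₘ-refl) ≡ₘ-refl) ⟩
      d' * (bₛ * a + c₀) * (bₛ * 0# * B + d) ≈⟨ ≈⇒≡ₘ (solve 6 (λ d' bₛ a c₀ B d → d' :* (bₛ :* a :+ c₀) :* (bₛ :* con 0 :* B :+ d) := (d' :* d) :* (bₛ :* a :+ c₀)) refl d' bₛ a c₀ B d) ⟩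
      (d' * d) * (bₛ * a + c₀)              ≈⟨ *-≡ₘ (proj₂ (diagonal-units U)) ≡ₘ-refl ⟩
      1# * (bₛ * a + c₀)                    ≈⟨ ≈⇒≡ₘ (*-identityˡ _) ⟩
      bₛ * a + c₀                           ∎
      where open ≡ₘ-Reasoning
    k : Carrier
    k = proj₁ (≡ₘ⇒offset (≡ₘ-sym bt≡))
    offset : bₛ * a + c₀ ≈ b t * (bₛ * q * B + d) + p * k
    offset = proj₂ (≡ₘ⇒offset (≡ₘ-sym bt≡))
    e₁ : p * a + 0# * c ≈ (a - B * (b t * q)) * p + (p * B) * (b t * q)
    e₁ = begin
      p * a + 0# * c                                 ≈⟨ trans (+-cong refl (zeroˡ c)) (+-identityʳ _) ⟩
      p * a                                          ≈⟨ sub-add-scaled p (B * (b t * q)) a ⟨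
      (a - B * (b t * q)) * p + p * (B * (b t * q))  ≈⟨ +-cong refl (sym (*-assoc p B _)) ⟩
      (a - B * (b t * q)) * p + (p * B) * (b t * q)  ∎
      where open ≈-Reasoning
    e₂ : p * B + 0# * d ≈ (a - B * (b t * q)) * 0# + (p * B) * 1#
    e₂ = solve 4 (λ p B d w → p :* B :+ con 0 :* d := w :* con 0 :+ (p :* B) :* con 1) refl p B d (a - B * (b t * q))
    e₃ : bₛ * q * a + 1# * c ≈ (q * k) * p + (bₛ * q * B + d) * (b t * q)
    e₃ = begin
      bₛ * q * a + 1# * c                         ≈⟨ +-cong refl (trans (*-identityˡ c) c≈qc₀) ⟩
      bₛ * q * a + q * c₀                         ≈⟨ solve 4 (λ bₛ q a c₀ → bₛ :* q :* a :+ q :* c₀ := q :* (bₛ :* a :+ c₀)) refl bₛ q a c₀ ⟩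
      q * (bₛ * a + c₀)                           ≈⟨ *-cong refl offset ⟩
      q * (b t * (bₛ * q * B + d) + p * k)        ≈⟨ solve 5 (λ q bt x p k → q :* (bt :* x :+ p :* k) := (q :* k) :* p :+ x :* (bt :* q)) refl q (b t) (bₛ * q * B + d) p k ⟩
      (q * k) * p + (bₛ * q * B + d) * (b t * q)  ∎
      where open ≈-Reasoning
    e₄ : bₛ * q * B + 1# * d ≈ (q * k) * 0# + (bₛ * q * B + d) * 1#
    e₄ = solve 5 (λ bₛ q B d k → bₛ :* q :* B :+ con 1 :* d := (q :* k) :* con 0 :+ (bₛ :* q :* B :+ d) :* con 1) refl bₛ q B d k

  -- βₛ ∈ 𝒪β_t gives bₛpⁿ = pⁿ(z p + b_t) for some z, so bₛ ≡ b_t (mod p), i.e. s = t.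
  β-separate : ∀ {s t} → L (β t) (β s) → s ≡ t
  β-separate {s} {t} (mat o₁ o₂ o₃ o₄ , (z , o₃≈qz) , (_ , _ , E₃ , E₄)) =
    residue-unique (0# , z , trans (trans (+-cong refl (zeroʳ p)) (+-identityʳ (b s))) bₛ≈)
    where
    open ≈-Reasoning
    o₄≈1 : o₄ ≈ 1#
    o₄≈1 = trans (solve 2 (λ o₃ o₄ → o₄ := o₃ :* con 0 :+ o₄ :* con 1) refl o₃ o₄) (sym E₄)
    bₛ≈ : b s ≈ b t + p * z
    bₛ≈ = cancel-q (begin
      q * b s                   ≈⟨ *-comm q (b s) ⟩
      b s * q                   ≈⟨ E₃ ⟩
      o₃ * p + o₄ * (b t * q)   ≈⟨ +-cong (*-cong o₃≈qz refl) (*-cong o₄≈1 refl) ⟩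
      (q * z) * p + 1# * (b t * q)
                                ≈⟨ solve 4 (λ q z p bt → (q :* z) :* p :+ con 1 :* (bt :* q) := q :* (bt :+ p :* z)) refl q z p (b t) ⟩
      q * (b t + p * z)         ∎)

  S₂-permuted : ∀ {ω} → Unit ω → MapsOnto R (S2 R p (sucℕ m) b) ω
  S₂-permuted = Permutation.mapsOnto β β-factor β-separate (S2 R p (sucℕ m) b)
    (λ P (s , β' , γβ'≋αγ , P≐L) → s , ≐-trans P≐L (L-cong (β-unique s γβ'≋αγ)))
    (λ P s P≐L → s , β s , β-conjugate s , P≐L)

lemma4p4 : ∀ {c ℓ} (R : CommutativeRing c ℓ) (p : CommutativeRing.Carrier R) →
           IsCompleteDVR R p → (n : ℕ) → 1 ≤ n →
           {i : Level} (I : Set i) (b : I → CommutativeRing.Carrier R) → IsResidueSystem R p b →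
           (ω : M2 (CommutativeRing.Carrier R)) → IsUnitO R p n ω →
           MapsOnto R (S1 R p n b) ω × MapsOnto R (S2 R p n b) ω
lemma4p4 R p D (sucℕ m) (s≤s z≤n) I b residues ω U = S₁-permuted U , S₂-permuted U
  where open Eichler R p D m I b residues
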